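{- In continued conjunctive compound Node-Kayles under misère play, the set $\mathcal{L}$ of integers $m\ge 0$ such that the single path $P_m$ is a $\mathcal{P}$-position is $$\mathcal{L}=\{7\cdot 2^n-6:\ n\ge 0\}\cup\{7\cdot 2^n-5:\ n\ge 0\}.$$
   Context: For $n\ge 0$, $P_n$ denotes the path on $n$ vertices ($P_0$ is the empty graph). A Node-Kayles move on a path $P_k$ with $k\ge 1$ chooses a vertex and deletes it together with its neighbours. The possible results are: $P_0$ if $k\in\{1,2\}$; $P_0$ or $P_1$ if $k=3$; and, for $k\ge 4$, $P_{k-2}$, $P_{k-3}$, or two paths $P_i,P_j$ with $j\ge i\ge1$, $i+j=k-3$. Continued conjunctive compound Node-Kayles is played by two players who move alternately, starting from a single path. A position is a finite multiset of paths (components). A move replaces every nonempty component simultaneously by the result of a Node-Kayles move on it; a split component yields two components. The game ends when all components are empty. Under misère play, the first player unable to move wins; equivalently, the player who made the last move loses. A position is a $\mathcal{P}$-position if the second player (the one not moving next) has a winning strategy, and an $\mathcal{N}$-position otherwise. -}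

module Defs where

open import Data.Nat using (ℕ; zero; suc; _+_; _≤_)
open import Data.List using (List; []; _∷_; [_]; _++_)
open import Data.List.Relation.Unary.All using (All)
open import Data.Product using (Σ; _×_)
open import Relation.Binary.PropositionalEquality using (_≡_)
open import Relation.Nullary using (¬_)

-- A position is a finite multiset of paths, represented as a list of path
-- lengths (order is irrelevant to play; a 0 entry is the empty path P₀).
Position : Set
Position = List ℕ

-- A single Node-Kayles move on P_k (k ≥ 1).  The result is the list of
-- nonempty paths left over (P₀ is represented by the empty list).
data NKMove : ℕ → List ℕ → Set where
  one     : NKMove 1 []
  two     : NKMove 2 []
  three₀  : NKMove 3 []
  three₁  : NKMove 3 [ 1 ]
  minus2  : ∀ r → NKMove (suc (suc (suc (suc r)))) [ suc (suc r) ]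
  minus3  : ∀ r → NKMove (suc (suc (suc (suc r)))) [ suc r ]
  split   : ∀ r i j → 1 ≤ i → i ≤ j → i + j ≡ suc r →
            NKMove (suc (suc (suc (suc r)))) (i ∷ j ∷ [])

-- A conjunctive-compound move: every nonempty component is simultaneously
-- replaced by the result of a Node-Kayles move on it.
data Step : Position → Position → Set where
  done  : Step [] []
  empty : ∀ {ps qs} → Step ps qs → Step (0 ∷ ps) qs
  play  : ∀ {k r ps qs} → NKMove (suc k) r → Step ps qs → Step (suc k ∷ ps) (r ++ qs)

Terminal : Position → Set
Terminal p = All (_≡ 0) p

-- Misère outcome classes (player to move in a terminal position cannot move
-- and therefore wins).  The game is finite, so these inductive classes are
-- exactly "second player wins" / "first player wins".
mutual
  data IsP : Position → Set where
    pPos : ∀ {p} → ¬ Terminal p → (∀ q → Step p q → IsN q) → IsP p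

  data IsN : Position → Set where
    nTerminal : ∀ {p} → Terminal p → IsN p
    nMove     : ∀ {p} q → Step p q → IsP q → IsN p

-- Following Smith, attach to every path P_k a suspense number s(k): the
-- lengths 7·2ⁿ − 6 and 7·2ⁿ − 5 get 2n+1, the other lengths below
-- 7·2ⁿ⁺¹ − 6 get 2n+2.  Every move from P_k leaves pieces of suspense at most
-- s(k); when s(k) is odd every move leaves exactly s(k) − 1, because the
-- largest remaining piece lies in the even band of the previous level; and
-- from every nonempty path some move leaves exactly s(k) − 1.  In a continued
-- conjunctive compound the game lasts as long as its longest component, so a
-- position is rated by the maximal suspense of its components, and this rating
-- drops by exactly one under every move from an odd rating and under some
-- move from a positive even one.  Hence (misère) the P-positions are those of
-- odd rating, and P_m is one exactly when m ∈ {7·2ⁿ − 6, 7·2ⁿ − 5}.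
module Submission where

open import Defs
open import Data.Nat using (ℕ; _*_; _∸_; _^_)
open import Data.List using ([_])
open import Data.Product using (∃)
open import Data.Sum using (_⊎_)
open import Relation.Binary.PropositionalEquality using (_≡_)
open import Function.Bundles using (_⇔_)

open import Data.Nat
  using (zero; suc; _+_; _⊔_; _≤_; _<_; z≤n; s≤s; s≤s⁻¹; _≤?_; _<?_; _≟_; parity)
open import Data.Nat.Properties
open import Data.Nat.Induction using (<-wellFounded)
open import Data.Nat.ListAction using (sum)
open import Data.Nat.ListAction.Properties using (sum-++)
open import Data.Nat.Tactic.RingSolver using (solve-∀)
open import Data.Parity.Base using (0ℙ; 1ℙ; _⁻¹)
open import Data.Parity.Properties using (suc-homo-⁻¹; +-homo-+; *-homo-*)
open import Data.List using (List; []; _∷_; _++_)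
open import Data.List.Relation.Unary.All using ([]; _∷_)
open import Data.Product using (Σ; _×_; _,_)
open import Data.Sum using (inj₁; inj₂)
open import Data.Empty using (⊥-elim)
open import Function using (_∘_)
open import Function.Bundles using (mk⇔)
open import Function.Properties.Equivalence using (⇔-setoid)
open import Induction.WellFounded using (Acc; acc)
open import Level using (0ℓ)
open import Relation.Nullary using (¬_; yes; no)
open import Relation.Binary.PropositionalEquality
  using (_≢_; refl; sym; trans; cong; cong₂; module ≡-Reasoning)

threshold : ℕ → ℕ
threshold zero    = 1
threshold (suc n) = 2 * threshold n + 6

threshold-gap : ∀ n → 2 + threshold n ≤ threshold (suc n)
threshold-gap n =
  ≤-trans (≤-reflexive (+-comm 2 t)) (+-mono-≤ (m≤n*m t 2) (s≤s (s≤s z≤n)))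
  where t = threshold n

threshold-<-suc : ∀ n → threshold n < threshold (suc n)
threshold-<-suc n = ≤-trans (n≤1+n _) (threshold-gap n)

threshold-mono : ∀ {m n} → m ≤ n → threshold m ≤ threshold n
threshold-mono {n = zero} z≤n = ≤-refl
threshold-mono {n = suc n} m≤1+n with m≤n⇒m<n∨m≡n m≤1+n
... | inj₂ refl = ≤-refl
... | inj₁ m<1+n = ≤-trans (threshold-mono (s≤s⁻¹ m<1+n)) (<⇒≤ (threshold-<-suc n))

record InLevel (k n : ℕ) : Set where
  constructor inLevel
  field
    lower : threshold n ≤ k
    upper : k < threshold (suc n)

levelOf : ∀ k → Σ ℕ (InLevel (suc k))
levelOf zero = 0 , inLevel ≤-refl (s≤s (s≤s z≤n))
levelOf (suc k) with levelOf k
... | n , inLevel lo hi with suc (suc k) <? threshold (suc n)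
...   | yes hi′ = n , inLevel (m≤n⇒m≤1+n lo) hi′
...   | no ¬hi′ = suc n , inLevel (≮⇒≥ ¬hi′) (≤-<-trans hi (threshold-<-suc (suc n)))

level-mono : ∀ {m k a b} → InLevel m a → InLevel k b → m ≤ k → a ≤ b
level-mono {a = a} {b} (inLevel lo _) (inLevel _ hi) m≤k with a ≤? b
... | yes a≤b = a≤b
... | no a≰b =
  ⊥-elim (≤⇒≯ (≤-trans (threshold-mono (≰⇒> a≰b)) (≤-trans lo m≤k)) hi)

level-unique : ∀ {k m n} → InLevel k m → InLevel k n → m ≡ n
level-unique x y = ≤-antisym (level-mono x y ≤-refl) (level-mono y x ≤-refl)

data Band (k : ℕ) : Set where
  odd-band  : ∀ n → threshold n ≤ k → k ≤ suc (threshold n) → Band k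
  even-band : ∀ n → 2 + threshold n ≤ k → k < threshold (suc n) → Band k

bandLevel : ∀ {k} → Band k → ℕ
bandLevel (odd-band n _ _)  = n
bandLevel (even-band n _ _) = n

band-inLevel : ∀ {k} (b : Band k) → InLevel k (bandLevel b)
band-inLevel (odd-band n lo hi)  = inLevel lo (≤-<-trans hi (threshold-gap n))
band-inLevel (even-band n lo hi) = inLevel (≤-trans (m≤n+m _ 2) lo) hi

band : ∀ k → Band (suc k)
band k with levelOf k
... | n , inLevel lo hi with suc k ≤? suc (threshold n)
...   | yes le = odd-band n lo le
...   | no gt  = even-band n (≰⇒> gt) hi

suspense : ℕ → ℕ
suspense zero = 0
suspense (suc k) with band k
... | odd-band n _ _  = suc (2 * n)
... | even-band n _ _ = 2 + 2 * n

suspense-odd-band : ∀ n {k} → threshold n ≤ k → k ≤ suc (threshold n) →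
                    suspense k ≡ suc (2 * n)
suspense-odd-band n {zero} lo _ = ⊥-elim (≤⇒≯ lo (threshold-mono {0} {n} z≤n))
suspense-odd-band n {suc k} lo hi with band k
... | b@(odd-band m _ _) =
  cong (λ l → suc (2 * l)) (level-unique (band-inLevel b) (band-inLevel (odd-band n lo hi)))
... | b@(even-band m lo′ _) with level-unique (band-inLevel b) (band-inLevel (odd-band n lo hi))
...   | refl = ⊥-elim (≤⇒≯ hi lo′)

suspense-even-band : ∀ n {k} → 2 + threshold n ≤ k → k < threshold (suc n) →
                     suspense k ≡ 2 + 2 * n
suspense-even-band n {suc k} lo hi with band k
... | b@(even-band m _ _) =
  cong (λ l → 2 + 2 * l) (level-unique (band-inLevel b) (band-inLevel (even-band n lo hi)))
... | b@(odd-band m _ hi′) with level-unique (band-inLevel b) (band-inLevel (even-band n lo hi))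
...   | refl = ⊥-elim (≤⇒≯ hi′ lo)

suspense-mono : ∀ {m k} → m ≤ k → suspense m ≤ suspense k
suspense-mono {zero} _ = z≤n
suspense-mono {suc m} {suc k} m≤k with band m | band k
... | x@(odd-band a _ _) | y@(odd-band b _ _) =
  s≤s (*-monoʳ-≤ 2 (level-mono (band-inLevel x) (band-inLevel y) m≤k))
... | x@(odd-band a _ _) | y@(even-band b _ _) =
  m≤n⇒m≤1+n (s≤s (*-monoʳ-≤ 2 (level-mono (band-inLevel x) (band-inLevel y) m≤k)))
... | x@(even-band a _ _) | y@(even-band b _ _) =
  s≤s (s≤s (*-monoʳ-≤ 2 (level-mono (band-inLevel x) (band-inLevel y) m≤k)))
... | x@(even-band a lo _) | y@(odd-band b _ hi) =
  m≤n⇒m≤1+n (≤-trans (≤-reflexive (sym (*-suc 2 a))) (*-monoʳ-≤ 2 a<b))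
  where
  a<b : a < b
  a<b = ≤∧≢⇒< (level-mono (band-inLevel x) (band-inLevel y) m≤k)
              (λ { refl → ≤⇒≯ (≤-trans m≤k hi) lo })

parity-odd : ∀ n → parity (suc (2 * n)) ≡ 1ℙ
parity-odd n = trans (+-homo-+ 1 (2 * n)) (cong _⁻¹ (*-homo-* 2 n))

parity-even : ∀ n → parity (2 + 2 * n) ≡ 0ℙ
parity-even n = *-homo-* 2 n

odd-band-parity : ∀ n {k} → threshold n ≤ k → k ≤ suc (threshold n) →
                  parity (suspense k) ≡ 1ℙ
odd-band-parity n lo hi = trans (cong parity (suspense-odd-band n lo hi)) (parity-odd n)

odd-suspense⇒odd-band : ∀ k → parity (suspense k) ≡ 1ℙ →
                        ∃ λ n → threshold n ≤ k × k ≤ suc (threshold n)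
odd-suspense⇒odd-band zero ()
odd-suspense⇒odd-band (suc k) odd with band k
... | odd-band n lo hi = n , lo , hi
... | even-band n lo hi
  with () ← trans (sym odd) (parity-even n)

-- The largest piece j left by a move on P_k (k ≥ 4) satisfies k − 3 ≤ 2j and j ≤ k − 2.
odd-band-drop : ∀ n {k j} → threshold n ≤ k → k ≤ suc (threshold n) →
                1 ≤ j → 2 + j ≤ k → k ≤ 3 + 2 * j → suspense j ≡ 2 * n
odd-band-drop zero _ hi 1≤j j+2≤k _ =
  ⊥-elim (≤⇒≯ hi (≤-trans (s≤s (s≤s 1≤j)) j+2≤k))
odd-band-drop (suc n) {k} {j} lo hi _ j+2≤k k≤3+2j =
  trans (suspense-even-band n t+2≤j (s≤s⁻¹ (≤-trans j+2≤k hi))) (sym (*-suc 2 n))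
  where
  t = threshold n
  3+2t≤2j : 3 + 2 * t ≤ 2 * j
  3+2t≤2j =
    +-cancelˡ-≤ 3 _ _ (≤-trans (≤-reflexive (+-comm 6 (2 * t))) (≤-trans lo k≤3+2j))
  t+2≤j : 2 + t ≤ j
  t+2≤j = *-cancelˡ-< 2 (suc t) j (≤-trans (≤-reflexive (cong suc (*-suc 2 t))) 3+2t≤2j)

suspenseOf : Position → ℕ
suspenseOf []      = 0
suspenseOf (k ∷ p) = suspense k ⊔ suspenseOf p

suspenseOf-++ : ∀ p q → suspenseOf (p ++ q) ≡ suspenseOf p ⊔ suspenseOf q
suspenseOf-++ []      q = refl
suspenseOf-++ (k ∷ p) q =
  trans (cong (suspense k ⊔_) (suspenseOf-++ p q)) (sym (⊔-assoc (suspense k) _ _))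

suspenseOf-singleton : ∀ k → suspenseOf [ k ] ≡ suspense k
suspenseOf-singleton k = ⊔-identityʳ (suspense k)

odd-band-singleton : ∀ n {j} → threshold n ≤ j → j ≤ suc (threshold n) →
                     suspenseOf [ j ] ≡ suc (2 * n)
odd-band-singleton n {j} lo hi = trans (suspenseOf-singleton j) (suspense-odd-band n lo hi)

suspenseOf-pair : ∀ {i j} → i ≤ j → suspenseOf (i ∷ j ∷ []) ≡ suspense j
suspenseOf-pair {i} {j} i≤j =
  trans (cong (suspense i ⊔_) (suspenseOf-singleton j)) (m≤n⇒m⊔n≡n (suspense-mono i≤j))

suspenseOf-≤-suspense-sum : ∀ p → suspenseOf p ≤ suspense (sum p)
suspenseOf-≤-suspense-sum []      = z≤n
suspenseOf-≤-suspense-sum (k ∷ p) =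
  ⊔-lub (suspense-mono (m≤m+n k (sum p)))
        (≤-trans (suspenseOf-≤-suspense-sum p) (suspense-mono (m≤n+m (sum p) k)))

move-size : ∀ {k r} → NKMove k r → sum r < k
move-size one    = s≤s z≤n
move-size two    = s≤s z≤n
move-size three₀ = s≤s z≤n
move-size three₁ = s≤s (s≤s z≤n)
move-size (minus2 r) rewrite +-identityʳ r = n≤1+n _
move-size (minus3 r) rewrite +-identityʳ r = m≤n⇒m≤1+n (n≤1+n _)
move-size (split r i j _ _ i+j≡1+r) rewrite +-identityʳ j | i+j≡1+r =
  m≤n⇒m≤1+n (n≤1+n _)

move-upper : ∀ {k r} → NKMove k r → suspenseOf r ≤ suspense k
move-upper {r = r} mv =
  ≤-trans (suspenseOf-≤-suspense-sum r) (suspense-mono (<⇒≤ (move-size mv)))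

odd-suspense-drop : ∀ k j → parity (suspense k) ≡ 1ℙ →
                    1 ≤ j → 2 + j ≤ k → k ≤ 3 + 2 * j → suspense j ≡ suspense k ∸ 1
odd-suspense-drop k j odd 1≤j j+2≤k k≤3+2j with odd-suspense⇒odd-band k odd
... | n , lo , hi rewrite suspense-odd-band n lo hi = odd-band-drop n lo hi 1≤j j+2≤k k≤3+2j

odd-move : ∀ {k r} → NKMove k r → parity (suspense k) ≡ 1ℙ →
           suspenseOf r ≡ suspense k ∸ 1
odd-move one    _ = refl
odd-move two    _ = refl
odd-move three₀ ()
odd-move three₁ ()
odd-move (minus2 r) odd =
  trans (suspenseOf-singleton (2 + r))
        (odd-suspense-drop (4 + r) (2 + r) odd (s≤s z≤n) ≤-refl
          (+-monoʳ-≤ 3 (≤-trans (n≤1+n _) (m≤n*m (2 + r) 2))))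
odd-move (minus3 r) odd =
  trans (suspenseOf-singleton (1 + r))
        (odd-suspense-drop (4 + r) (1 + r) odd (s≤s z≤n) (n≤1+n _)
          (+-monoʳ-≤ 3 (m≤n*m (1 + r) 2)))
odd-move (split r i j 1≤i i≤j i+j≡1+r) odd =
  trans (suspenseOf-pair i≤j)
        (odd-suspense-drop (4 + r) j odd (≤-trans 1≤i i≤j)
          (m≤n⇒m≤1+n (+-monoʳ-≤ 2 (≤-trans (m≤n+m j i) (≤-reflexive i+j≡1+r))))
          (+-monoʳ-≤ 3 (begin
            suc r   ≡⟨ sym i+j≡1+r ⟩
            i + j   ≤⟨ +-monoˡ-≤ j i≤j ⟩
            j + j   ≡⟨ cong (j +_) (sym (+-identityʳ j)) ⟩
            2 * j   ∎)))
  where open ≤-Reasoning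

MoveTo : ℕ → ℕ → Set
MoveTo k s = Σ (List ℕ) λ r → NKMove k r × suspenseOf r ≡ s

-- Cut the path so that its largest piece lands in the odd band of the same level.
even-band-move : ∀ n r → 2 + threshold n ≤ 4 + r → 4 + r < threshold (suc n) →
                 MoveTo (4 + r) (suc (2 * n))
even-band-move n r lo hi with 2 + r ≤? suc (threshold n)
... | yes le = _ , minus2 r , odd-band-singleton n (s≤s⁻¹ (s≤s⁻¹ lo)) le
... | no gt with 1 + r ≤? suc (threshold n)
...   | yes le = _ , minus3 r , odd-band-singleton n (<⇒≤ (s≤s⁻¹ (≰⇒> gt))) le
...   | no gt′ = _ , split r (r ∸ t) (suc t) 1≤i i≤j i+j≡1+r ,
                 trans (suspenseOf-pair i≤j) (suspense-odd-band n (n≤1+n t) ≤-refl)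
  where
  twice-plus-six : ∀ t → 2 * t + 6 ≡ 5 + (t + suc t)
  twice-plus-six = solve-∀
  t = threshold n
  t<r : t < r
  t<r = s≤s⁻¹ (≰⇒> gt′)
  1≤i : 1 ≤ r ∸ t
  1≤i = m<n⇒0<n∸m t<r
  i≤j : r ∸ t ≤ suc t
  i≤j = m≤n+o⇒m∸n≤o r t
          (+-cancelˡ-≤ 5 r (t + suc t) (≤-trans hi (≤-reflexive (twice-plus-six t))))
  i+j≡1+r : r ∸ t + suc t ≡ suc r
  i+j≡1+r = trans (+-suc (r ∸ t) t) (cong suc (m∸n+n≡m (<⇒≤ t<r)))

drop-move : ∀ k → MoveTo (suc k) (suspense (suc k) ∸ 1)
drop-move 0 = [] , one , refl
drop-move 1 = [] , two , refl
drop-move 2 = [ 1 ] , three₁ , refl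
drop-move (suc (suc (suc r))) = from-band (band (3 + r))
  where
  from-band : Band (4 + r) → MoveTo (4 + r) (suspense (4 + r) ∸ 1)
  from-band (odd-band n lo hi) = _ , minus2 r , odd-move (minus2 r) (odd-band-parity n lo hi)
  from-band (even-band n lo hi) = let res , mv , e = even-band-move n r lo hi in
    res , mv , trans e (cong (_∸ 1) (sym (suspense-even-band n lo hi)))

move-within : ∀ {k r V} → NKMove k r → suspense k ≤ V → parity V ≡ 1ℙ →
              suspenseOf r ≤ V ∸ 1
move-within {V = zero} _ _ ()
move-within {k} {V = suc w} mv k≤V odd with suspense k ≟ suc w
... | yes k≡V =
  ≤-reflexive (trans (odd-move mv (trans (cong parity k≡V) odd)) (cong (_∸ 1) k≡V))
... | no k≢V  = ≤-trans (move-upper mv) (s≤s⁻¹ (≤∧≢⇒< k≤V k≢V))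

step-within : ∀ {p q V} → Step p q → suspenseOf p ≤ V → parity V ≡ 1ℙ →
              suspenseOf q ≤ V ∸ 1
step-within done        _   _   = z≤n
step-within (empty st)  p≤V odd = step-within st p≤V odd
step-within (play {r = r} {qs = qs} mv st) p≤V odd =
  ≤-trans (≤-reflexive (suspenseOf-++ r qs))
          (⊔-lub (move-within mv (≤-trans (m≤m⊔n _ _) p≤V) odd)
                 (step-within st (≤-trans (m≤n⊔m _ _) p≤V) odd))

step-lower : ∀ {p q} → Step p q → parity (suspenseOf p) ≡ 1ℙ →
             suspenseOf p ∸ 1 ≤ suspenseOf q
step-lower done ()
step-lower (empty st) odd = step-lower st odd
step-lower (play {k} {r} {ps} {qs} mv st) odd
  with ⊔-sel (suspense (suc k)) (suspenseOf ps)
... | inj₁ e = begin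
  suspenseOf (suc k ∷ ps) ∸ 1  ≡⟨ cong (_∸ 1) e ⟩
  suspense (suc k) ∸ 1         ≡⟨ odd-move mv (trans (cong parity (sym e)) odd) ⟨
  suspenseOf r                 ≤⟨ m≤m⊔n _ _ ⟩
  suspenseOf r ⊔ suspenseOf qs ≡⟨ suspenseOf-++ r qs ⟨
  suspenseOf (r ++ qs)         ∎
  where open ≤-Reasoning
... | inj₂ e = begin
  suspenseOf (suc k ∷ ps) ∸ 1  ≡⟨ cong (_∸ 1) e ⟩
  suspenseOf ps ∸ 1            ≤⟨ step-lower st (trans (cong parity (sym e)) odd) ⟩
  suspenseOf qs                ≤⟨ m≤n⊔m _ _ ⟩
  suspenseOf r ⊔ suspenseOf qs ≡⟨ suspenseOf-++ r qs ⟨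
  suspenseOf (r ++ qs)         ∎
  where open ≤-Reasoning

odd-step : ∀ {p q} → Step p q → parity (suspenseOf p) ≡ 1ℙ →
           suspenseOf q ≡ suspenseOf p ∸ 1
odd-step st odd = ≤-antisym (step-within st ≤-refl odd) (step-lower st odd)

drop-step : ∀ p → Σ Position λ q → Step p q × suspenseOf q ≡ suspenseOf p ∸ 1
drop-step [] = [] , done , refl
drop-step (zero ∷ p) with drop-step p
... | q , st , e = q , empty st , e
drop-step (suc k ∷ p) with drop-move k | drop-step p
... | r , mv , e | q , st , e′ = r ++ q , play mv st , (begin
  suspenseOf (r ++ q)                          ≡⟨ suspenseOf-++ r q ⟩
  suspenseOf r ⊔ suspenseOf q                  ≡⟨ cong₂ _⊔_ e e′ ⟩
  (suspense (suc k) ∸ 1) ⊔ (suspenseOf p ∸ 1)  ≡⟨ ∸-distribʳ-⊔ 1 (suspense (suc k)) _ ⟨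
  suspenseOf (suc k ∷ p) ∸ 1                   ∎)
  where open ≡-Reasoning

terminal⇒suspenseOf≡0 : ∀ {p} → Terminal p → suspenseOf p ≡ 0
terminal⇒suspenseOf≡0 []         = refl
terminal⇒suspenseOf≡0 (refl ∷ t) = terminal⇒suspenseOf≡0 t

suspenseOf≡0⇒terminal : ∀ p → suspenseOf p ≡ 0 → Terminal p
suspenseOf≡0⇒terminal []          _ = []
suspenseOf≡0⇒terminal (zero ∷ p)  e = refl ∷ suspenseOf≡0⇒terminal p e
suspenseOf≡0⇒terminal (suc k ∷ p) e =
  ⊥-elim (≤⇒≯ (≤-trans (m≤m⊔n (suspense (suc k)) _) (≤-reflexive e))
              (suspense-mono {1} {suc k} (s≤s z≤n)))

step-size-≤ : ∀ {p q} → Step p q → sum q ≤ sum p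
step-size-≤ done       = z≤n
step-size-≤ (empty st) = step-size-≤ st
step-size-≤ (play {r = r} {qs = qs} mv st) =
  ≤-trans (≤-reflexive (sum-++ r qs)) (+-mono-≤ (<⇒≤ (move-size mv)) (step-size-≤ st))

step-size-< : ∀ {p q} → Step p q → ¬ Terminal p → sum q < sum p
step-size-< done       nt = ⊥-elim (nt [])
step-size-< (empty st) nt = step-size-< st (nt ∘ (refl ∷_))
step-size-< (play {r = r} {qs = qs} mv st) _ =
  ≤-<-trans (≤-reflexive (sum-++ r qs)) (+-mono-<-≤ (move-size mv) (step-size-≤ st))

odd⇒pred-even : ∀ {x} → parity x ≡ 1ℙ → parity (x ∸ 1) ≡ 0ℙ
odd⇒pred-even {suc w} odd = trans (sym (suc-homo-⁻¹ w)) (cong _⁻¹ odd)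

even⇒pred-odd : ∀ {x} → x ≢ 0 → parity x ≡ 0ℙ → parity (x ∸ 1) ≡ 1ℙ
even⇒pred-odd {zero}  x≢0 _    = ⊥-elim (x≢0 refl)
even⇒pred-odd {suc w} _   even = trans (sym (suc-homo-⁻¹ w)) (cong _⁻¹ even)

mutual
  odd⇒IsP : ∀ p → Acc _<_ (sum p) → parity (suspenseOf p) ≡ 1ℙ → IsP p
  odd⇒IsP p (acc smaller) odd = pPos nonterminal λ q st →
    even⇒IsN q (smaller (step-size-< st nonterminal))
              (trans (cong parity (odd-step st odd)) (odd⇒pred-even {suspenseOf p} odd))
    where
    nonterminal : ¬ Terminal p
    nonterminal t with () ← trans (sym odd) (cong parity (terminal⇒suspenseOf≡0 t))

  even⇒IsN : ∀ p → Acc _<_ (sum p) → parity (suspenseOf p) ≡ 0ℙ → IsN p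
  even⇒IsN p (acc smaller) even with suspenseOf p ≟ 0
  ... | yes p≡0 = nTerminal (suspenseOf≡0⇒terminal p p≡0)
  ... | no p≢0 with drop-step p
  ...   | q , st , e =
    nMove q st (odd⇒IsP q (smaller (step-size-< st (p≢0 ∘ terminal⇒suspenseOf≡0)))
                          (trans (cong parity e) (even⇒pred-odd p≢0 even)))

IsP⇒¬IsN : ∀ {p} → IsP p → ¬ IsN p
IsP⇒¬IsN (pPos nt _)       (nTerminal t)     = nt t
IsP⇒¬IsN (pPos _ next)     (nMove q st isP)  = IsP⇒¬IsN isP (next q st)

IsP⇔odd : ∀ p → IsP p ⇔ parity (suspenseOf p) ≡ 1ℙ
IsP⇔odd p = mk⇔ to (odd⇒IsP p (<-wellFounded (sum p)))
  where
  to : IsP p → parity (suspenseOf p) ≡ 1ℙ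
  to isP with parity (suspenseOf p) in e
  ... | 1ℙ = refl
  ... | 0ℙ = ⊥-elim (IsP⇒¬IsN isP (even⇒IsN p (<-wellFounded (sum p)) e))

odd-path⇔odd-band : ∀ m → parity (suspenseOf [ m ]) ≡ 1ℙ ⇔
                    (∃ λ n → threshold n ≤ m × m ≤ suc (threshold n))
odd-path⇔odd-band m = mk⇔
  (λ odd → odd-suspense⇒odd-band m (trans (cong parity (sym (suspenseOf-singleton m))) odd))
  (λ (n , lo , hi) → trans (cong parity (suspenseOf-singleton m)) (odd-band-parity n lo hi))

threshold-closed-form : ∀ n → threshold n + 6 ≡ 7 * 2 ^ n
threshold-closed-form zero    = refl
threshold-closed-form (suc n) = begin
  2 * t + 6 + 6     ≡⟨ +-assoc (2 * t) 6 6 ⟩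
  2 * t + 2 * 6     ≡⟨ *-distribˡ-+ 2 t 6 ⟨
  2 * (t + 6)       ≡⟨ cong (2 *_) (threshold-closed-form n) ⟩
  2 * (7 * 2 ^ n)   ≡⟨ *-assoc 2 7 (2 ^ n) ⟨
  14 * 2 ^ n        ≡⟨ *-assoc 7 2 (2 ^ n) ⟩
  7 * (2 * 2 ^ n)   ∎
  where
  t = threshold n
  open ≡-Reasoning

threshold≡7*2^n∸6 : ∀ n → threshold n ≡ 7 * 2 ^ n ∸ 6
threshold≡7*2^n∸6 n =
  trans (sym (m+n∸n≡m (threshold n) 6)) (cong (_∸ 6) (threshold-closed-form n))

suc-threshold≡7*2^n∸5 : ∀ n → suc (threshold n) ≡ 7 * 2 ^ n ∸ 5
suc-threshold≡7*2^n∸5 n =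
  trans (sym (m+n∸n≡m (suc (threshold n)) 5))
        (cong (_∸ 5) (trans (sym (+-suc (threshold n) 5)) (threshold-closed-form n)))

odd-band⇔closed-form : ∀ m → (∃ λ n → threshold n ≤ m × m ≤ suc (threshold n)) ⇔
                       ((∃ λ n → m ≡ 7 * 2 ^ n ∸ 6) ⊎ (∃ λ n → m ≡ 7 * 2 ^ n ∸ 5))
odd-band⇔closed-form m = mk⇔ to from
  where
  to : (∃ λ n → threshold n ≤ m × m ≤ suc (threshold n)) →
       (∃ λ n → m ≡ 7 * 2 ^ n ∸ 6) ⊎ (∃ λ n → m ≡ 7 * 2 ^ n ∸ 5)
  to (n , lo , hi) with m≤n⇒m<n∨m≡n hi
  ... | inj₁ m<1+t =
    inj₁ (n , trans (≤-antisym (s≤s⁻¹ m<1+t) lo) (threshold≡7*2^n∸6 n))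
  ... | inj₂ m≡1+t = inj₂ (n , trans m≡1+t (suc-threshold≡7*2^n∸5 n))
  from : (∃ λ n → m ≡ 7 * 2 ^ n ∸ 6) ⊎ (∃ λ n → m ≡ 7 * 2 ^ n ∸ 5) →
         ∃ λ n → threshold n ≤ m × m ≤ suc (threshold n)
  from (inj₁ (n , e)) = n , ≤-reflexive (sym m≡t) , m≤n⇒m≤1+n (≤-reflexive m≡t)
    where m≡t = trans e (sym (threshold≡7*2^n∸6 n))
  from (inj₂ (n , e)) =
    n , ≤-trans (n≤1+n _) (≤-reflexive (sym m≡1+t)) , ≤-reflexive m≡1+t
    where m≡1+t = trans e (sym (suc-threshold≡7*2^n∸5 n))

corollary5 : ∀ (m : ℕ) →
    IsP [ m ] ⇔ ((∃ λ n → m ≡ 7 * 2 ^ n ∸ 6) ⊎ (∃ λ n → m ≡ 7 * 2 ^ n ∸ 5))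
corollary5 m = begin
  IsP [ m ]                                           ≈⟨ IsP⇔odd [ m ] ⟩
  parity (suspenseOf [ m ]) ≡ 1ℙ                      ≈⟨ odd-path⇔odd-band m ⟩
  (∃ λ n → threshold n ≤ m × m ≤ suc (threshold n))  ≈⟨ odd-band⇔closed-form m ⟩
  ((∃ λ n → m ≡ 7 * 2 ^ n ∸ 6) ⊎ (∃ λ n → m ≡ 7 * 2 ^ n ∸ 5)) ∎
  where open import Relation.Binary.Reasoning.Setoid (⇔-setoid 0ℓ)
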